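{- Let $T=(F_0,F_1)$ be the pair of $10\times 10$ binary arrays (rows and columns indexed $0,\dots,9$) in which the entry in row $i$, column $j$ is the two-bit string $F_0[i,j]F_1[i,j]$ given by the following rows: row 0: 11 00 00 00 01 01 01 10 10 10; row 1: 00 11 00 00 01 01 01 10 10 10; row 2: 00 00 11 00 10 10 10 01 01 01; row 3: 00 00 00 11 10 10 10 01 01 01; row 4: 10 10 01 01 11 11 00 00 00 00; row 5: 10 10 01 01 11 11 00 00 00 00; row 6: 10 10 01 01 00 00 11 11 00 00; row 7: 01 01 10 10 00 00 11 11 00 00; row 8: 01 01 10 10 00 00 00 00 11 11; row 9: 01 01 10 10 00 00 00 00 11 11. Regard $T$ as a template of order $10$ and type $(4,4,4,4)$ (rows $0$–$3$ and columns $0$–$3$ relational). Then there is no $4$-net of order $10$ that is a refinement of $T$.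
   Context: A $4$-net of order $10$ is a set of $100$ points with $40$ lines of size $10$, partitioned into $4$ parallel classes $\Pi_0,\Pi_1,\Pi_2,\Pi_3$ of $10$ pairwise disjoint lines, such that any two lines from different classes meet in exactly one point. Equivalently, identifying points with cells of a $10\times10$ array with $\Pi_0$ the rows and $\Pi_1$ the columns, $\Pi_2$ and $\Pi_3$ are given by a pair of orthogonal Latin squares $L_0,L_1$ (a line is the set of cells containing a given symbol). A template of order $10$ and type $(4,4,4,4)$ is a pair $(F_0,F_1)$ of orthogonal binary $10\times10$ frequency squares, each with exactly $4$ ones in every row and column (orthogonal meaning the number of cells with entry pair $(a,b)$ is $f_af_b$ with $f_1=4,f_0=6$), with rows $0$–$3$ and columns $0$–$3$ declared relational, such that each cell $(i,j)$ has an even number of ones in the string $x\,y\,F_0[i,j]F_1[i,j]$, where $x=1$ iff $i\le3$ and $y=1$ iff $j\le 3$. The $4$-net is a refinement of the template if there are maps $\theta_0,\theta_1$ from symbols to $\{0,1\}$ with $\theta_m(L_m[r,c])=F_m[r,c]$ for all cells and $m=0,1$. -}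

module Defs where

open import Data.Nat using (ℕ)
open import Data.Fin using (Fin)
open import Data.Bool using (Bool; true; false)
open import Data.Product using (_×_; Σ; ∃)
open import Data.Vec using (Vec; []; _∷_; lookup)
open import Relation.Binary.PropositionalEquality using (_≡_)

Square : ℕ → Set
Square n = Fin n → Fin n → Fin n

-- Latin square: each symbol occurs exactly once in every row and every column
-- (on Fin n, injectivity of each row/column map is equivalent to bijectivity).
IsLatin : ∀ {n} → Square n → Set
IsLatin {n} L =
  (∀ (r c c' : Fin n) → L r c ≡ L r c' → c ≡ c') ×
  (∀ (c r r' : Fin n) → L r c ≡ L r' c → r ≡ r')

-- Orthogonality: each ordered pair of symbols occurs in at most (hence exactly) one cell.
Orthogonal : ∀ {n} → Square n → Square n → Set
Orthogonal {n} L₀ L₁ =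
  ∀ (r c r' c' : Fin n) → L₀ r c ≡ L₀ r' c' → L₁ r c ≡ L₁ r' c' → (r ≡ r') × (c ≡ c')

-- A 4-net of order n in coordinates: rows, columns, and the symbol classes of a pair
-- of mutually orthogonal Latin squares.
Is4Net : ∀ {n} → Square n → Square n → Set
Is4Net L₀ L₁ = IsLatin L₀ × IsLatin L₁ × Orthogonal L₀ L₁

BinArray : ℕ → Set
BinArray n = Fin n → Fin n → Bool

Refines : ∀ {n} → Square n → Square n → BinArray n → BinArray n → Set
Refines {n} L₀ L₁ F₀ F₁ =
  Σ (Fin n → Bool) λ θ₀ → Σ (Fin n → Bool) λ θ₁ →
    (∀ (r c : Fin n) → θ₀ (L₀ r c) ≡ F₀ r c) ×
    (∀ (r c : Fin n) → θ₁ (L₁ r c) ≡ F₁ r c)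

private
  O : Bool
  O = false
  I : Bool
  I = true

F₀rows : Vec (Vec Bool 10) 10
F₀rows =
  (I ∷ O ∷ O ∷ O ∷ O ∷ O ∷ O ∷ I ∷ I ∷ I ∷ []) ∷
  (O ∷ I ∷ O ∷ O ∷ O ∷ O ∷ O ∷ I ∷ I ∷ I ∷ []) ∷
  (O ∷ O ∷ I ∷ O ∷ I ∷ I ∷ I ∷ O ∷ O ∷ O ∷ []) ∷
  (O ∷ O ∷ O ∷ I ∷ I ∷ I ∷ I ∷ O ∷ O ∷ O ∷ []) ∷
  (I ∷ I ∷ O ∷ O ∷ I ∷ I ∷ O ∷ O ∷ O ∷ O ∷ []) ∷
  (I ∷ I ∷ O ∷ O ∷ I ∷ I ∷ O ∷ O ∷ O ∷ O ∷ []) ∷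
  (I ∷ I ∷ O ∷ O ∷ O ∷ O ∷ I ∷ I ∷ O ∷ O ∷ []) ∷
  (O ∷ O ∷ I ∷ I ∷ O ∷ O ∷ I ∷ I ∷ O ∷ O ∷ []) ∷
  (O ∷ O ∷ I ∷ I ∷ O ∷ O ∷ O ∷ O ∷ I ∷ I ∷ []) ∷
  (O ∷ O ∷ I ∷ I ∷ O ∷ O ∷ O ∷ O ∷ I ∷ I ∷ []) ∷ []

F₁rows : Vec (Vec Bool 10) 10
F₁rows =
  (I ∷ O ∷ O ∷ O ∷ I ∷ I ∷ I ∷ O ∷ O ∷ O ∷ []) ∷
  (O ∷ I ∷ O ∷ O ∷ I ∷ I ∷ I ∷ O ∷ O ∷ O ∷ []) ∷
  (O ∷ O ∷ I ∷ O ∷ O ∷ O ∷ O ∷ I ∷ I ∷ I ∷ []) ∷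
  (O ∷ O ∷ O ∷ I ∷ O ∷ O ∷ O ∷ I ∷ I ∷ I ∷ []) ∷
  (O ∷ O ∷ I ∷ I ∷ I ∷ I ∷ O ∷ O ∷ O ∷ O ∷ []) ∷
  (O ∷ O ∷ I ∷ I ∷ I ∷ I ∷ O ∷ O ∷ O ∷ O ∷ []) ∷
  (O ∷ O ∷ I ∷ I ∷ O ∷ O ∷ I ∷ I ∷ O ∷ O ∷ []) ∷
  (I ∷ I ∷ O ∷ O ∷ O ∷ O ∷ I ∷ I ∷ O ∷ O ∷ []) ∷
  (I ∷ I ∷ O ∷ O ∷ O ∷ O ∷ O ∷ O ∷ I ∷ I ∷ []) ∷
  (I ∷ I ∷ O ∷ O ∷ O ∷ O ∷ O ∷ O ∷ I ∷ I ∷ []) ∷ []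

T₀ : BinArray 10
T₀ i j = lookup (lookup F₀rows i) j

T₁ : BinArray 10
T₁ i j = lookup (lookup F₁rows i) j

{-# OPTIONS --safe #-}
module Submission where

-- A symbol a of L₀ with θ₀ a = 1 occupies one cell per row and per column, all of
-- T₀-type 1: a transversal σ of the ones of T₀.  By orthogonality the symbols of L₁
-- along σ are all different, so σ meets exactly as many ones of T₁ as there are
-- symbols with θ₁ = 1, namely 4.  An exhaustive search over the transversals of T₀
-- shows that such a σ never contains both (0,0) and (1,1), and passes through (6,7)
-- as soon as it contains one of them (by counting, exactly one of rows 0–3 of σ uses
-- its diagonal cell, and a short case analysis does the rest).  The symbols in cells (0,0) and (1,1) both have
-- θ₀ = 1, so both occupy (6,7): they coincide, and their line contains both cells.

open import Defs
open import Data.Bool using (Bool; true; if_then_else_)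
import Data.Bool as Bool
open import Data.Fin using (Fin; zero; suc; punchOut)
open import Data.Fin.Patterns
open import Data.Fin.Permutation using (permutation)
open import Data.Fin.Properties using (_≟_; any?; pigeonhole; punchOut-injective; suc-injective; <⇒≢; 0≢1+n)
open import Data.List using (List; [_]; concatMap; map; filter; allFin)
open import Data.List.Membership.Propositional using (_∈_)
open import Data.List.Membership.Propositional.Properties using (∈-concatMap⁺; ∈-map⁺; ∈-filter⁺; ∈-allFin)
open import Data.List.Relation.Unary.All as All using (All; all?)
import Data.List.Relation.Unary.Any as Any
open import Data.Nat using (ℕ)
import Data.Nat as ℕ
open import Data.Nat.Properties using (+-0-commutativeMonoid; n<1+n)
open import Data.Product using (_×_; _,_; proj₁; proj₂)
open import Data.Sum using (_⊎_; inj₁; inj₂)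
open import Data.Vec using (Vec; []; _∷_; lookup; tabulate)
import Data.Vec.Membership.DecPropositional as VecMembership
open import Data.Vec.Membership.Propositional using () renaming (_∈_ to _∈ᵥ_)
open import Data.Vec.Relation.Unary.Any.Properties using (tabulate⁻)
open import Function using (_∘_)
open import Function.Definitions using (Injective; Surjective)
open import Relation.Binary.PropositionalEquality using (_≡_; _≢_; refl; sym; trans; cong; module ≡-Reasoning)
open import Relation.Nullary using (¬_; ¬?; yes; no)
open import Relation.Nullary.Decidable using (_×-dec_; _⊎-dec_; _→-dec_; from-yes)
open import Relation.Nullary.Negation using (contradiction)
open import Algebra.Properties.CommutativeMonoid.Sum +-0-commutativeMonoid
  using (sum; sum-permute; sum-cong-≗)

count : ∀ {n} → (Fin n → Bool) → ℕ
count p = sum (λ i → if p i then 1 else 0)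

count-cong : ∀ {n} {p q : Fin n → Bool} → (∀ i → p i ≡ q i) → count p ≡ count q
count-cong p≗q = sum-cong-≗ (λ i → cong (λ b → if b then 1 else 0) (p≗q i))

injective⇒surjective : ∀ {n} {f : Fin n → Fin n} → Injective _≡_ _≡_ f → Surjective _≡_ _≡_ f
injective⇒surjective {ℕ.suc n} {f} f-inj y with any? (λ x → f x ≟ y)
... | yes (x , fx≡y) = x , λ { refl → fx≡y }
... | no y∉im =
  let i , j , i<j , eq = pigeonhole (n<1+n n) (λ x → punchOut (y≢f x))
  in  contradiction (f-inj (punchOut-injective (y≢f i) (y≢f j) eq)) (<⇒≢ i<j)
  where
  y≢f : ∀ x → y ≢ f x
  y≢f x = y∉im ∘ (x ,_) ∘ sym

count-∘-injective : ∀ {n} (p : Fin n → Bool) {f : Fin n → Fin n} →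
                    Injective _≡_ _≡_ f → count (p ∘ f) ≡ count p
count-∘-injective {n} p {f} f-inj = sym (sum-permute _ π)
  where
  f-surj = injective⇒surjective f-inj
  f⁻¹ : Fin n → Fin n
  f⁻¹ y = proj₁ (f-surj y)
  π = permutation f f⁻¹ (λ y → proj₂ (f-surj y) refl) (λ x → f-inj (proj₂ (f-surj (f x)) refl))

module Latin {n} {L : Square n} (latin : IsLatin L) where

  row-injective : ∀ r → Injective _≡_ _≡_ (L r)
  row-injective r {c} {c'} = proj₁ latin r c c'

  -- columnOf a is the line of symbol a, read as a transversal of the array
  columnOf : Fin n → Fin n → Fin n
  columnOf a r = proj₁ (injective⇒surjective (row-injective r) a)

  L-columnOf : ∀ a r → L r (columnOf a r) ≡ a
  L-columnOf a r = proj₂ (injective⇒surjective (row-injective r) a) refl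

  columnOf-unique : ∀ {a r c} → L r c ≡ a → columnOf a r ≡ c
  columnOf-unique Lrc≡a = row-injective _ (trans (L-columnOf _ _) (sym Lrc≡a))

  columnOf-injective : ∀ a → Injective _≡_ _≡_ (columnOf a)
  columnOf-injective a {r} {r'} eq =
    proj₂ latin (columnOf a r) r r' (trans (L-columnOf a r) (sym (trans (cong (L r') eq) (L-columnOf a r'))))

module Net {n} {L₀ L₁ : Square n} (net : Is4Net L₀ L₁) where

  open Latin (proj₁ net) public

  L₁-along-line-injective : ∀ a → Injective _≡_ _≡_ (λ r → L₁ r (columnOf a r))
  L₁-along-line-injective a {r} {r'} eq =
    proj₁ (proj₂ (proj₂ net) r _ r' _ (trans (L-columnOf a r) (sym (L-columnOf a r'))) eq)

  line-on-ones : ∀ {θ₀ : Fin n → Bool} {F₀ : BinArray n} → (∀ r c → θ₀ (L₀ r c) ≡ F₀ r c) →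
                ∀ {a} → θ₀ a ≡ true → ∀ r → F₀ r (columnOf a r) ≡ true
  line-on-ones {θ₀} h₀ {a} θ₀a r = trans (sym (h₀ r _)) (trans (cong θ₀ (L-columnOf a r)) θ₀a)

  line-weight : ∀ (θ₁ : Fin n → Bool) {F₁ : BinArray n} → (∀ r c → θ₁ (L₁ r c) ≡ F₁ r c) →
                ∀ a r₀ → count (λ r → F₁ r (columnOf a r)) ≡ count (F₁ r₀)
  line-weight θ₁ {F₁} h₁ a r₀ = begin
    count (λ r → F₁ r (columnOf a r))     ≡⟨ count-cong (λ r → sym (h₁ r _)) ⟩
    count (θ₁ ∘ λ r → L₁ r (columnOf a r)) ≡⟨ count-∘-injective θ₁ (L₁-along-line-injective a) ⟩
    count θ₁                              ≡⟨ count-∘-injective θ₁ (Latin.row-injective (proj₁ (proj₂ net)) r₀) ⟨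
    count (θ₁ ∘ L₁ r₀)                    ≡⟨ count-cong (h₁ r₀) ⟩
    count (F₁ r₀)                         ∎
    where open ≡-Reasoning

transversals : ∀ {m n} → (Fin m → Fin n → Bool) → List (Vec (Fin n) m)
transversals {ℕ.zero} A = [ [] ]
transversals {ℕ.suc m} {n} A = concatMap extensions (transversals (A ∘ suc))
  where
  open VecMembership (_≟_ {n}) using (_∈?_)
  extensions : Vec (Fin n) m → List (Vec (Fin n) (ℕ.suc m))
  extensions t = map (_∷ t) (filter (λ c → A zero c Bool.≟ true ×-dec ¬? (c ∈? t)) (allFin n))

tabulate∈transversals : ∀ {m n} (A : Fin m → Fin n → Bool) {σ : Fin m → Fin n} →
                        Injective _≡_ _≡_ σ → (∀ r → A r (σ r) ≡ true) → tabulate σ ∈ transversals A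
tabulate∈transversals {ℕ.zero} A σ-inj inside = Any.here refl
tabulate∈transversals {ℕ.suc m} A {σ} σ-inj inside =
  ∈-concatMap⁺ _ (Any.map (λ { refl → ∈-map⁺ (_∷ _) (∈-filter⁺ _ (∈-allFin (σ zero)) (inside zero , σ₀∉tail)) })
                          (tabulate∈transversals (A ∘ suc) (suc-injective ∘ σ-inj) (inside ∘ suc)))
  where
  σ₀∉tail : ¬ σ zero ∈ᵥ tabulate (σ ∘ suc)
  σ₀∉tail σ₀∈tail = 0≢1+n (σ-inj (proj₂ (tabulate⁻ σ₀∈tail)))

DiagonalRule : (Fin 10 → Fin 10) → Set
DiagonalRule σ = (σ 0F ≡ 0F ⊎ σ 1F ≡ 1F → σ 6F ≡ 7F) × ¬ (σ 0F ≡ 0F × σ 1F ≡ 1F)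

T-transversals-obey-DiagonalRule :
  All (λ t → count (λ r → T₁ r (lookup t r)) ≡ 4 → DiagonalRule (lookup t)) (transversals T₀)
T-transversals-obey-DiagonalRule = from-yes (all? rule? (transversals T₀))
  where
  rule? = λ t → count (λ r → T₁ r (lookup t r)) ℕ.≟ 4 →-dec
                ((lookup t 0F ≟ 0F ⊎-dec lookup t 1F ≟ 1F) →-dec lookup t 6F ≟ 7F) ×-dec
                ¬? (lookup t 0F ≟ 0F ×-dec lookup t 1F ≟ 1F)

T-transversal-DiagonalRule : (σ : Fin 10 → Fin 10) → Injective _≡_ _≡_ σ →
                             (∀ r → T₀ r (σ r) ≡ true) → count (λ r → T₁ r (σ r)) ≡ 4 →
                             DiagonalRule σ
T-transversal-DiagonalRule σ σ-inj inside =
  All.lookup T-transversals-obey-DiagonalRule (tabulate∈transversals T₀ σ-inj inside)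

lemma3p3 : ∀ (L₀ L₁ : Square 10) → ¬ (Is4Net L₀ L₁ × Refines L₀ L₁ T₀ T₁)
lemma3p3 L₀ L₁ (net , θ₀ , θ₁ , h₀ , h₁) =
  proj₂ (line-rule a (h₀ 0F 0F)) (columnOf-unique refl , columnOf-unique (sym a≡b))
  where
  open Net net
  open ≡-Reasoning

  line-rule : ∀ a → θ₀ a ≡ true → DiagonalRule (columnOf a)
  line-rule a θ₀a = T-transversal-DiagonalRule (columnOf a) (columnOf-injective a)
                      (line-on-ones h₀ θ₀a) (line-weight θ₁ h₁ a 0F)

  a b : Fin 10
  a = L₀ 0F 0F
  b = L₀ 1F 1F

  a-via-67 : columnOf a 6F ≡ 7F
  a-via-67 = proj₁ (line-rule a (h₀ 0F 0F)) (inj₁ (columnOf-unique refl))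

  b-via-67 : columnOf b 6F ≡ 7F
  b-via-67 = proj₁ (line-rule b (h₀ 1F 1F)) (inj₂ (columnOf-unique refl))

  a≡b : a ≡ b
  a≡b = begin
    a                      ≡⟨ L-columnOf a 6F ⟨
    L₀ 6F (columnOf a 6F)  ≡⟨ cong (L₀ 6F) a-via-67 ⟩
    L₀ 6F 7F               ≡⟨ cong (L₀ 6F) b-via-67 ⟨
    L₀ 6F (columnOf b 6F)  ≡⟨ L-columnOf b 6F ⟩
    b                      ∎
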